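{- Let $q$ be a square-free positive integer and suppose the triple $(a,b,2^k)\in T_q$ is an irreducible solution of $X^2+qY^2=Z^2$. If $(x,y,2^r)\in T_q$ and $r\geq k$, then there exists $n\in\mathbb{Z}$ such that $[x,y,2^r]=n\cdot[a,b,2^k]$ in $\mathcal{P}_q$.
   Context: $T_q$ is the set of integer triples $(a,b,c)\in\mathbb{Z}\times\mathbb{Z}\times\mathbb{N}$ ($\mathbb{N}$ the positive integers) with $a^2+qb^2=c^2$. Two triples $(a,b,c),(A,B,C)$ are equivalent if there exist nonzero integers $m,n$ with $(ma,mb,|mc|)=(nA,nB,|nC|)$; the class of $(a,b,c)$ is $[a,b,c]$ and $\mathcal{P}_q$ is the set of classes, an abelian group under $[a,b,c]+[A,B,C]:=[aA-qbB,\ aB+bA,\ cC]$ with identity $[1,0,1]$ and inverse $-[a,b,c]=[a,-b,c]$. For $n\in\mathbb{Z}$, $n\cdot g$ denotes the $n$-fold sum of $g$ (using inverses for $n<0$). A triple $(a,b,c)\in T_q$ is primitive if $\gcd(a,b,c)=1$; every class contains a primitive triple, unique up to the sign change $(a,b,c)\mapsto(-a,-b,c)$. An irreducible solution is a primitive triple $(a,b,c)\in T_q$ with $c>1$ whose class is a generator of $\mathcal{P}_q$ in the sense that it cannot be written as $[a_1,b_1,c_1]+[a_2,b_2,c_2]$ with $(a_i,b_i,c_i)$ primitive triples in $T_q$ satisfying $1<c_i<c$ for $i=1,2$. -}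

module Defs where

open import Data.Nat as ℕ using (ℕ)
open import Data.Nat.Divisibility as ℕD using ()
open import Data.Integer as ℤ using (ℤ; +_; _+_; _-_; _*_; -_; ∣_∣; _<_; 0ℤ; 1ℤ)
open import Data.Integer.GCD using (gcd)
open import Data.Product using (_×_; _,_; ∃; ∃-syntax)
open import Relation.Binary.PropositionalEquality using (_≡_; _≢_)
open import Relation.Nullary using (¬_)

SquareFree : ℕ → Set
SquareFree q = ∀ (d : ℕ) → (d ℕ.* d) ℕD.∣ q → d ≡ 1

Triple : Set
Triple = ℤ × ℤ × ℤ

InT : ℕ → Triple → Set
InT q (a , b , c) = ((a * a) + ((+ q) * (b * b)) ≡ c * c) × (0ℤ < c)

_∼_ : Triple → Triple → Set
(a , b , c) ∼ (A , B , C) =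
  ∃[ m ] ∃[ n ] (m ≢ 0ℤ) × (n ≢ 0ℤ) ×
    (m * a ≡ n * A) × (m * b ≡ n * B) × (∣ m * c ∣ ≡ ∣ n * C ∣)

add : ℕ → Triple → Triple → Triple
add q (a , b , c) (A , B , C) = ((a * A) - ((+ q) * (b * B)) , (a * B) + (b * A) , c * C)

idT : Triple
idT = (1ℤ , 0ℤ , 1ℤ)

negT : Triple → Triple
negT (a , b , c) = (a , - b , c)

natMul : ℕ → ℕ → Triple → Triple
natMul q ℕ.zero g = idT
natMul q (ℕ.suc n) g = add q (natMul q n g) g

zMul : ℕ → ℤ → Triple → Triple
zMul q (+ n) g = natMul q n g
zMul q ℤ.-[1+ n ] g = negT (natMul q (ℕ.suc n) g)

Primitive : Triple → Set
Primitive (a , b , c) = gcd a (gcd b c) ≡ 1ℤ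

third : Triple → ℤ
third (_ , _ , c) = c

Irreducible : ℕ → Triple → Set
Irreducible q t =
  InT q t × Primitive t × (1ℤ < third t) ×
  ¬ (∃[ t₁ ] ∃[ t₂ ] InT q t₁ × Primitive t₁ × InT q t₂ × Primitive t₂ ×
       (1ℤ < third t₁) × (third t₁ < third t) ×
       (1ℤ < third t₂) × (third t₂ < third t) ×
       (t ∼ add q t₁ t₂))

{-# OPTIONS --safe #-}
module Submission where

-- A solution (x , y , 2^r) is a point (x , y) of level r, points multiply by
-- (x , y) · (e , f) = (xe − qyf , xf + ye), and a class is a point up to a nonzero scalar, so
-- n·[a , b , 2^k] is the class of the n-th power of g = (a , b).  Primitivity and square-freeness
-- force a, b and q to be odd, and then a point of positive level either is twice a point of the
-- level below or has both coordinates odd.  An odd point P of level r ≥ k ≥ 2 is divisible by g or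
-- by its conjugate: 2^(2k−1) divides P · conj g or P · g, and the quotient W, of the lower level
-- r − k + 1, satisfies 2 P = W · g or 2 P = W · conj g.  Strong induction on the level then shows
-- that every point is proportional to a power of g; the base cases are level 0 (the identity) and,
-- when k = 1, the points (±1 , ±1), which are proportional to g or to its conjugate.  Irreducibility
-- excludes odd points E of level 1 ≤ j < k: for j = 1 they would force q ≡ 3 (mod 8) while g forces
-- q ≡ 7 (mod 8), and for j ≥ 2 dividing g by E in the same way would decompose [a , b , 2^k] into
-- classes of levels below k.

open import Defs
open import Data.Nat using (ℕ; _^_; _≤_; _>_)
open import Data.Integer using (ℤ; +_)
open import Data.Product using (_,_; ∃-syntax)

open import Agda.Builtin.FromNat using (Number; fromNat)
open import Data.Empty using (⊥; ⊥-elim)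
open import Data.Integer as ℤ using (-[1+_]; _+_; _*_; _-_; -_; ∣_∣; 0ℤ; 1ℤ; -1ℤ)
import Data.Integer.DivMod as ℤ
import Data.Integer.Literals as ℤL
import Data.Nat.Literals as ℕL
import Data.Integer.Properties as ℤ
open import Data.Integer.Divisibility.Signed using (_∣_; divides; ∣-trans; ∣ᵤ⇒∣)
import Data.Integer.GCD as ℤ
open import Data.Integer.Tactic.RingSolver using (solve; solve-∀)
open import Data.List using (_∷_; [])
open import Data.Nat as ℕ using (zero; suc; _<_; z≤n; s≤s)
import Data.Nat.Properties as ℕ
import Data.Nat.Coprimality as ℕ
import Data.Nat.Divisibility as ℕ
import Data.Nat.GCD as ℕ
open import Data.Nat.Induction using (<-rec)
open import Data.Product using (_×_; proj₁; proj₂)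
open import Data.Sum as Sum using (_⊎_; inj₁; inj₂; [_,_]′)
open import Data.Unit using (tt)
open import Relation.Binary.PropositionalEquality
open import Relation.Nullary using (¬_; yes; no)
open import Relation.Binary.Definitions using (tri<; tri≈; tri>)

instance
  ℕ-number : Number ℕ
  ℕ-number = ℕL.number
  ℤ-number : Number ℤ
  ℤ-number = ℤL.number

Even Odd : ℤ → Set
Even z = ∃[ t ] z ≡ 2 * t
Odd  z = ∃[ t ] z ≡ 1 + 2 * t

parity : ∀ z → Even z ⊎ Odd z
parity z = by-remainder (z ℤ.%ℕ 2) (z ℤ./ℕ 2) (ℤ.n%ℕd<d z 2) (ℤ.a≡a%ℕn+[a/ℕn]*n z 2)
  where
  by-remainder : ∀ r w → r < 2 → z ≡ + r + w * 2 → Even z ⊎ Odd z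
  by-remainder 0 w _ eq = inj₁ (w , trans eq (solve (w ∷ [])))
  by-remainder 1 w _ eq = inj₂ (w , trans eq (solve (w ∷ [])))
  by-remainder (suc (suc _)) _ (s≤s (s≤s ())) _

2*t≢1 : ∀ t → 2 * t ≢ 1ℤ
2*t≢1 t eq with ℕ.m*n≡1⇒m≡1 2 ∣ t ∣ (trans (sym (ℤ.abs-* 2 t)) (cong ∣_∣ eq))
... | ()

odd⇒¬even : ∀ {z} → Odd z → ¬ Even z
odd⇒¬even (s , refl) (t , eq) = 2*t≢1 (t - s) (begin
  2 * (t - s)        ≡⟨ solve (t ∷ s ∷ []) ⟩
  2 * t - 2 * s      ≡⟨ cong (_- 2 * s) eq ⟨
  1 + 2 * s - 2 * s  ≡⟨ solve (s ∷ []) ⟩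
  1ℤ                 ∎)
  where open ≡-Reasoning

odd⇒≢0 : ∀ {z} → Odd z → z ≢ 0ℤ
odd⇒≢0 odd refl = odd⇒¬even odd (0ℤ , refl)

odd*odd : ∀ {a b} → Odd a → Odd b → Odd (a * b)
odd*odd (s , refl) (t , refl) = s + t + 2 * s * t , solve (s ∷ t ∷ [])

odd+odd : ∀ {a b} → Odd a → Odd b → Even (a + b)
odd+odd (s , refl) (t , refl) = 1 + s + t , solve (s ∷ t ∷ [])

odd-odd : ∀ {a b} → Odd a → Odd b → Even (a - b)
odd-odd (s , refl) (t , refl) = s - t , solve (s ∷ t ∷ [])

odd+even : ∀ {a b} → Odd a → Even b → Odd (a + b)
odd+even (s , refl) (t , refl) = s + t , solve (s ∷ t ∷ [])

even+even : ∀ {a b} → Even a → Even b → Even (a + b)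
even+even (s , refl) (t , refl) = s + t , solve (s ∷ t ∷ [])

even*ˡ : ∀ {a} b → Even a → Even (a * b)
even*ˡ b (s , refl) = s * b , solve (s ∷ b ∷ [])

even*ʳ : ∀ a {b} → Even b → Even (a * b)
even*ʳ a (t , refl) = a * t , solve (a ∷ t ∷ [])

even-t*[1+t] : ∀ t → Even (t * (1 + t))
even-t*[1+t] t with parity t
... | inj₁ even-t = even*ˡ (1 + t) even-t
... | inj₂ (s , refl) = even*ʳ (1 + 2 * s) {1 + (1 + 2 * s)} (1 + s , solve (s ∷ []))

odd-square : ∀ {x} → Odd x → ∃[ A ] x * x ≡ 1 + 8 * A
odd-square (t , refl) with even-t*[1+t] t
... | M , eq = M , (begin
  (1 + 2 * t) * (1 + 2 * t)  ≡⟨ solve (t ∷ []) ⟩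
  1 + 4 * (t * (1 + t))      ≡⟨ cong (λ m → 1 + 4 * m) eq ⟩
  1 + 4 * (2 * M)            ≡⟨ solve (M ∷ []) ⟩
  1 + 8 * M                  ∎)
  where open ≡-Reasoning

pow2 : ℕ → ℤ
pow2 n = + (2 ^ n)

pow2-suc : ∀ n → pow2 (suc n) ≡ 2 * pow2 n
pow2-suc n = ℤ.pos-* 2 (2 ^ n)

pow2-suc-* : ∀ n W → pow2 (suc n) * W ≡ 2 * (pow2 n * W)
pow2-suc-* n W = trans (cong (_* W) (pow2-suc n)) (ℤ.*-assoc 2 (pow2 n) W)

pow2-+ : ∀ m n → pow2 (m ℕ.+ n) ≡ pow2 m * pow2 n
pow2-+ m n = trans (cong +_ (ℕ.^-distribˡ-+-* 2 m n)) (ℤ.pos-* (2 ^ m) (2 ^ n))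

pow2≢0 : ∀ n → pow2 n ≢ 0ℤ
pow2≢0 n eq with ℕ.m^n≡0⇒m≡0 2 n (ℤ.+-injective eq)
... | ()

pow2-pos : ∀ n → 0ℤ ℤ.< pow2 n
pow2-pos n = ℤ.+<+ (ℕ.m^n>0 2 n)

pow2-mono-< : ∀ {m n} → m < n → pow2 m ℤ.< pow2 n
pow2-mono-< m<n = ℤ.+<+ (ℕ.^-monoʳ-< 2 (s≤s (s≤s z≤n)) m<n)

pow2-2+ : ∀ j → pow2 (2 ℕ.+ j) ≡ 2 * (2 * pow2 j)
pow2-2+ j = trans (pow2-suc (suc j)) (cong (2 *_) (pow2-suc j))

pow2-2+j+d : ∀ j d → pow2 (2 ℕ.+ j ℕ.+ d) ≡ 2 * (2 * pow2 j) * pow2 d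
pow2-2+j+d j d = trans (pow2-+ (2 ℕ.+ j) d) (cong (_* pow2 d) (pow2-2+ j))

pow2-double-suc : ∀ j → pow2 (suc j ℕ.+ suc j) ≡ 2 * pow2 j * (2 * pow2 j)
pow2-double-suc j = trans (pow2-+ (suc j) (suc j)) (cong₂ _*_ (pow2-suc j) (pow2-suc j))

square-pow2-suc : ∀ r → pow2 (suc r) * pow2 (suc r) ≡ 4 * (pow2 r * pow2 r)
square-pow2-suc r = trans (cong₂ _*_ (pow2-suc r) (pow2-suc r)) (four-factors (pow2 r))
  where
  four-factors : ∀ a → 2 * a * (2 * a) ≡ 4 * (a * a)
  four-factors = solve-∀

square-pow2-suc-even : ∀ r → Even (pow2 (suc r) * pow2 (suc r))
square-pow2-suc-even r = even*ˡ (pow2 (suc r)) (pow2 r , pow2-suc r)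

pow2∣⇒pow2-suc∣2* : ∀ n {t} → pow2 n ∣ t → pow2 (suc n) ∣ 2 * t
pow2∣⇒pow2-suc∣2* n (divides w refl) = divides w (begin
  2 * (w * pow2 n)     ≡⟨ ℤ.*-assoc 2 w (pow2 n) ⟨
  2 * w * pow2 n       ≡⟨ cong (_* pow2 n) (ℤ.*-comm 2 w) ⟩
  w * 2 * pow2 n       ≡⟨ ℤ.*-assoc w 2 (pow2 n) ⟩
  w * (2 * pow2 n)     ≡⟨ cong (w *_) (pow2-suc n) ⟨
  w * pow2 (suc n)     ∎)
  where open ≡-Reasoning

pow2∣odd*⇒pow2∣ : ∀ n {s s′} W → Odd s → s * s′ ≡ pow2 n * W → pow2 n ∣ s′
pow2∣odd*⇒pow2∣ zero {s′ = s′} _ _ _ = divides s′ (sym (ℤ.*-identityʳ s′))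
pow2∣odd*⇒pow2∣ (suc n) {s} {s′} W odd-s eq with parity s′
... | inj₂ odd-s′ = ⊥-elim (odd⇒¬even (odd*odd odd-s odd-s′) (pow2 n * W , trans eq (pow2-suc-* n W)))
... | inj₁ (t , refl) = pow2∣⇒pow2-suc∣2* n (pow2∣odd*⇒pow2∣ n W odd-s (ℤ.*-cancelˡ-≡ 2 (s * t) (pow2 n * W) (begin
  2 * (s * t)       ≡⟨ solve (s ∷ t ∷ []) ⟩
  s * (2 * t)       ≡⟨ eq ⟩
  pow2 (suc n) * W  ≡⟨ pow2-suc-* n W ⟩
  2 * (pow2 n * W)  ∎)))
  where open ≡-Reasoning

TwiceOdd : ℤ → Set
TwiceOdd v = ∃[ t ] Odd t × v ≡ 2 * t

Split : ℤ → ℤ → ℤ → Set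
Split κ u u′ = (TwiceOdd u × κ ∣ u′) ⊎ (TwiceOdd u′ × κ ∣ u)

-- u and u′ are 2s and 2s′ with s + s′ = m odd, so exactly one of s, s′ is odd, and 2ⁿ divides the other.
conjugate-split : ∀ n {u u′ m} W → Odd m → Even u → u + u′ ≡ 2 * m → u * u′ ≡ 4 * (pow2 n * W) →
  Split (pow2 (suc n)) u u′
conjugate-split n {u′ = u′} {m} W odd-m (s , refl) sum product = split (parity s) (parity (m - s))
  where
  open ≡-Reasoning
  u′≡ : u′ ≡ 2 * (m - s)
  u′≡ = begin
    u′                  ≡⟨ solve (s ∷ u′ ∷ []) ⟩
    2 * s + u′ - 2 * s  ≡⟨ cong (_- 2 * s) sum ⟩
    2 * m - 2 * s       ≡⟨ solve (m ∷ s ∷ []) ⟩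
    2 * (m - s)         ∎
  s*s′ : s * (m - s) ≡ pow2 n * W
  s*s′ = ℤ.*-cancelˡ-≡ 4 _ _ (begin
    4 * (s * (m - s))      ≡⟨ solve (s ∷ m ∷ []) ⟩
    2 * s * (2 * (m - s))  ≡⟨ cong (2 * s *_) u′≡ ⟨
    2 * s * u′             ≡⟨ product ⟩
    4 * (pow2 n * W)       ∎)
  split : Even s ⊎ Odd s → Even (m - s) ⊎ Odd (m - s) → Split (pow2 (suc n)) (2 * s) u′
  split (inj₂ odd-s) _ = inj₁ ((s , odd-s , refl) ,
    subst (pow2 (suc n) ∣_) (sym u′≡) (pow2∣⇒pow2-suc∣2* n (pow2∣odd*⇒pow2∣ n W odd-s s*s′)))
  split (inj₁ _) (inj₂ odd-s′) = inj₂ ((m - s , odd-s′ , u′≡) ,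
    pow2∣⇒pow2-suc∣2* n (pow2∣odd*⇒pow2∣ n W odd-s′ (trans (ℤ.*-comm (m - s) s) s*s′)))
  split (inj₁ even-s) (inj₁ even-s′) =
    ⊥-elim (odd⇒¬even odd-m (subst Even recombine (even+even even-s even-s′)))
    where
    recombine : s + (m - s) ≡ m
    recombine = solve (s ∷ m ∷ [])

*≢0 : ∀ {a b} → a ≢ 0ℤ → b ≢ 0ℤ → a * b ≢ 0ℤ
*≢0 {a} a≢0 b≢0 eq = [ a≢0 , b≢0 ]′ (ℤ.i*j≡0⇒i≡0∨j≡0 a eq)

square-injective : ∀ u v → u * u ≡ v * v → ∣ u ∣ ≡ ∣ v ∣
square-injective u v eq with ℕ.<-cmp ∣ u ∣ ∣ v ∣ | trans (sym (ℤ.abs-* u u)) (trans (cong ∣_∣ eq) (ℤ.abs-* v v))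
... | tri< u<v _ _ | eq′ = ⊥-elim (ℕ.<-irrefl eq′ (ℕ.*-mono-< u<v u<v))
... | tri≈ _ u≡v _ | _   = u≡v
... | tri> _ _ v<u | eq′ = ⊥-elim (ℕ.<-irrefl (sym eq′) (ℕ.*-mono-< v<u v<u))

-- The ring solver accepts only variables as atoms, so identities involving the parameter Q are
-- stated for an arbitrary Q and then instantiated.
brahmagupta : ∀ Q x y e f →
  (x * e - Q * (y * f)) * (x * e - Q * (y * f)) + Q * ((x * f + y * e) * (x * f + y * e))
    ≡ (x * x + Q * (y * y)) * (e * e + Q * (f * f))
brahmagupta = solve-∀

module Points (Q : ℤ) where

  Point : Set
  Point = ℤ × ℤ

  norm : Point → ℤ
  norm (x , y) = x * x + Q * (y * y)

  infixl 7 _·_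
  _·_ : Point → Point → Point
  (x , y) · (e , f) = x * e - Q * (y * f) , x * f + y * e

  conj : Point → Point
  conj (x , y) = x , - y

  infixr 8 _•_
  _•_ : ℤ → Point → Point
  c • (x , y) = c * x , c * y

  norm-· : ∀ P E → norm (P · E) ≡ norm P * norm E
  norm-· (x , y) (e , f) = brahmagupta Q x y e f

  norm-conj : ∀ P → norm (conj P) ≡ norm P
  norm-conj (x , y) = cong (λ t → x * x + Q * t) (neg*neg y)
    where
    neg*neg : ∀ y → - y * - y ≡ y * y
    neg*neg = solve-∀

  norm-• : ∀ c P → norm (c • P) ≡ c * c * norm P
  norm-• c (x , y) = norm-scale Q c x y
    where
    norm-scale : ∀ Q c x y → c * x * (c * x) + Q * (c * y * (c * y)) ≡ c * c * (x * x + Q * (y * y))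
    norm-scale = solve-∀

  •-• : ∀ c d P → c • d • P ≡ (c * d) • P
  •-• c d (x , y) = cong₂ _,_ (sym (ℤ.*-assoc c d x)) (sym (ℤ.*-assoc c d y))

  •-injective : ∀ {c P P′} → c ≢ 0ℤ → c • P ≡ c • P′ → P ≡ P′
  •-injective {c} c≢0 eq = cong₂ _,_ (ℤ.*-cancelˡ-≡ c _ _ {{ℤ.≢-nonZero c≢0}} (cong proj₁ eq))
                                     (ℤ.*-cancelˡ-≡ c _ _ {{ℤ.≢-nonZero c≢0}} (cong proj₂ eq))

  •-· : ∀ c P E → c • (P · E) ≡ (c • P) · E
  •-· c (x , y) (e , f) = cong₂ _,_ (first Q c x y e f) (second c x y e f)
    where
    first : ∀ Q c x y e f → c * (x * e - Q * (y * f)) ≡ c * x * e - Q * (c * y * f)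
    first = solve-∀
    second : ∀ c x y e f → c * (x * f + y * e) ≡ c * x * f + c * y * e
    second = solve-∀

  ·-·conj : ∀ P E → P · E · conj E ≡ norm E • P
  ·-·conj (x , y) (e , f) = cong₂ _,_ (first Q x y e f) (second Q x y e f)
    where
    first : ∀ Q x y e f →
      (x * e - Q * (y * f)) * e - Q * ((x * f + y * e) * - f) ≡ (e * e + Q * (f * f)) * x
    first = solve-∀
    second : ∀ Q x y e f →
      (x * e - Q * (y * f)) * - f + (x * f + y * e) * e ≡ (e * e + Q * (f * f)) * y
    second = solve-∀

  conj-involutive : ∀ P → conj (conj P) ≡ P
  conj-involutive (x , y) = cong (x ,_) (ℤ.neg-involutive y)

  conj-· : ∀ P E → conj (P · E) ≡ conj P · conj E
  conj-· (x , y) (e , f) = cong₂ _,_ (first Q x y e f) (second x y e f)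
    where
    first : ∀ Q x y e f → x * e - Q * (y * f) ≡ x * e - Q * (- y * - f)
    first = solve-∀
    second : ∀ x y e f → - (x * f + y * e) ≡ x * - f + - y * e
    second = solve-∀

  conj[·]-· : ∀ P E → conj (P · E) · E ≡ norm E • conj P
  conj[·]-· (x , y) (e , f) = cong₂ _,_ (first Q x y e f) (second Q x y e f)
    where
    first : ∀ Q x y e f →
      (x * e - Q * (y * f)) * e - Q * (- (x * f + y * e) * f) ≡ (e * e + Q * (f * f)) * x
    first = solve-∀
    second : ∀ Q x y e f →
      (x * e - Q * (y * f)) * f + - (x * f + y * e) * e ≡ (e * e + Q * (f * f)) * - y
    second = solve-∀

  1·-identity : ∀ E → (1ℤ , 0ℤ) · E ≡ E
  1·-identity (e , f) = cong₂ _,_ (first Q e f) (second e f)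
    where
    first : ∀ Q e f → 1ℤ * e - Q * (0ℤ * f) ≡ e
    first = solve-∀
    second : ∀ e f → 1ℤ * f + 0ℤ * e ≡ f
    second = solve-∀

  infix 4 _∝_
  _∝_ : Point → Point → Set
  P ∝ P′ = ∃[ m ] ∃[ m′ ] m ≢ 0ℤ × m′ ≢ 0ℤ × m • P ≡ m′ • P′

  ∝-reflexive : ∀ {P P′} → P ≡ P′ → P ∝ P′
  ∝-reflexive refl = 1ℤ , 1ℤ , (λ ()) , (λ ()) , refl

  ∝-trans : ∀ {P P′ P″} → P ∝ P′ → P′ ∝ P″ → P ∝ P″
  ∝-trans {P} {P′} {P″} (m₁ , m₁′ , m₁≢0 , m₁′≢0 , eq₁) (m₂ , m₂′ , m₂≢0 , m₂′≢0 , eq₂) =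
    m₂ * m₁ , m₁′ * m₂′ , *≢0 m₂≢0 m₁≢0 , *≢0 m₁′≢0 m₂′≢0 , (begin
      (m₂ * m₁) • P      ≡⟨ •-• m₂ m₁ P ⟨
      m₂ • m₁ • P        ≡⟨ cong (m₂ •_) eq₁ ⟩
      m₂ • m₁′ • P′      ≡⟨ •-• m₂ m₁′ P′ ⟩
      (m₂ * m₁′) • P′    ≡⟨ cong (_• P′) (ℤ.*-comm m₂ m₁′) ⟩
      (m₁′ * m₂) • P′    ≡⟨ •-• m₁′ m₂ P′ ⟨
      m₁′ • m₂ • P′      ≡⟨ cong (m₁′ •_) eq₂ ⟩
      m₁′ • m₂′ • P″     ≡⟨ •-• m₁′ m₂′ P″ ⟩
      (m₁′ * m₂′) • P″   ∎)
    where open ≡-Reasoning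

  •-∝ : ∀ {c} P → c ≢ 0ℤ → c • P ∝ P
  •-∝ {c} P c≢0 = 1ℤ , c , (λ ()) , c≢0 , trans (•-• 1ℤ c P) (cong (_• P) (ℤ.*-identityˡ c))

  negated : ∀ x y → (- x , - y) ∝ (x , y)
  negated x y = ∝-trans (∝-reflexive (cong₂ _,_ (sym (ℤ.-1*i≡-i x)) (sym (ℤ.-1*i≡-i y)))) (•-∝ { -1ℤ} (x , y) (λ ()))

  ∝-sym : ∀ {P P′} → P ∝ P′ → P′ ∝ P
  ∝-sym (m , m′ , m≢0 , m′≢0 , eq) = m′ , m , m′≢0 , m≢0 , sym eq

  •≡⇒∝ : ∀ {c P X} → c ≢ 0ℤ → c • P ≡ X → P ∝ X
  •≡⇒∝ {c} {P} c≢0 refl = ∝-sym (•-∝ P c≢0)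

  ∝-·ʳ : ∀ {P P′} E → P ∝ P′ → P · E ∝ P′ · E
  ∝-·ʳ {P} {P′} E (m , m′ , m≢0 , m′≢0 , eq) = m , m′ , m≢0 , m′≢0 , (begin
    m • (P · E)     ≡⟨ •-· m P E ⟩
    (m • P) · E     ≡⟨ cong (_· E) eq ⟩
    (m′ • P′) · E   ≡⟨ •-· m′ P′ E ⟨
    m′ • (P′ · E)   ∎)
    where open ≡-Reasoning

  Level : ℕ → Point → Set
  Level r P = norm P ≡ pow2 r * pow2 r

  OddPoint : Point → Set
  OddPoint (x , y) = Odd x × Odd y

  level-halve : ∀ {r} P → Level (suc r) (2 • P) → Level r P
  level-halve {r} P level =
    ℤ.*-cancelˡ-≡ 4 (norm P) (pow2 r * pow2 r) (trans (sym (norm-• 2 P)) (trans level (square-pow2-suc r)))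

  level-suc-parity : Odd Q → ∀ {r x y} → Level (suc r) (x , y) → (Even x × Even y) ⊎ OddPoint (x , y)
  level-suc-parity odd-Q {r} {x} {y} level with parity x | parity y
  ... | inj₁ even-x | inj₁ even-y = inj₁ (even-x , even-y)
  ... | inj₂ odd-x  | inj₂ odd-y  = inj₂ (odd-x , odd-y)
  ... | inj₂ odd-x  | inj₁ even-y =
    ⊥-elim (odd⇒¬even (subst Odd level (odd+even (odd*odd odd-x odd-x) (even*ʳ Q (even*ˡ y even-y)))) (square-pow2-suc-even r))
  ... | inj₁ even-x | inj₂ odd-y  =
    ⊥-elim (odd⇒¬even (subst Odd (trans (ℤ.+-comm (Q * (y * y)) (x * x)) level) (odd+even (odd*odd odd-Q (odd*odd odd-y odd-y)) (even*ˡ x even-x)))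
                      (square-pow2-suc-even r))

  odd-norm-mod-8 : ∀ {P} → OddPoint P → ∃[ D ] norm P ≡ 1 + Q + 8 * D
  odd-norm-mod-8 {x , y} (odd-x , odd-y) with odd-square odd-x | odd-square odd-y
  ... | A , x²≡ | B , y²≡ = A + Q * B , (begin
    x * x + Q * (y * y)              ≡⟨ cong₂ (λ a b → a + Q * b) x²≡ y²≡ ⟩
    1 + 8 * A + Q * (1 + 8 * B)      ≡⟨ solve (Q ∷ A ∷ B ∷ []) ⟩
    1 + Q + 8 * (A + Q * B)          ∎)
    where open ≡-Reasoning

  -- Odd points at level 1 force Q ≡ 3 (mod 8), odd points at levels ≥ 2 force Q ≡ 7 (mod 8).
  odd-level-one⇒no-odd-level-2+ : ∀ {P E} r → OddPoint P → Level 1 P → OddPoint E → Level (2 ℕ.+ r) E → ⊥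
  odd-level-one⇒no-odd-level-2+ {P} {E} r odd-P level-P odd-E level-E =
    2*t≢1 (2 * R - D₂ + D₁) (ℤ.*-cancelˡ-≡ 4 _ _ (mod-8-clash R D₁ D₂ norm-P norm-E))
    where
    R D₁ D₂ : ℤ
    R  = pow2 r * pow2 r
    D₁ = proj₁ (odd-norm-mod-8 odd-P)
    D₂ = proj₁ (odd-norm-mod-8 odd-E)
    norm-P : 1 + Q + 8 * D₁ ≡ 4
    norm-P = trans (sym (proj₂ (odd-norm-mod-8 odd-P))) level-P
    norm-E : 1 + Q + 8 * D₂ ≡ 16 * R
    norm-E = trans (sym (proj₂ (odd-norm-mod-8 odd-E)))
      (trans level-E (trans (square-pow2-suc (suc r)) (trans (cong (4 *_) (square-pow2-suc r)) (sym (ℤ.*-assoc 4 4 R)))))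
    mod-8-clash : ∀ R D₁ D₂ → 1 + Q + 8 * D₁ ≡ 4 → 1 + Q + 8 * D₂ ≡ 16 * R → 4 * (2 * (2 * R - D₂ + D₁)) ≡ 4 * 1ℤ
    mod-8-clash R D₁ D₂ eq₁ eq₂ = begin
      4 * (2 * (2 * R - D₂ + D₁))                    ≡⟨ solve (R ∷ D₁ ∷ D₂ ∷ Q ∷ []) ⟩
      16 * R - (1 + Q + 8 * D₂) + (1 + Q + 8 * D₁)  ≡⟨ cong₂ (λ a b → 16 * R - a + b) eq₂ eq₁ ⟩
      16 * R - 16 * R + 4                            ≡⟨ solve (R ∷ []) ⟩
      4 * 1ℤ                                         ∎
      where open ≡-Reasoning

  odd-point⇒Q≢1 : ∀ {P} r → OddPoint P → Level (suc r) P → Q ≢ 1ℤ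
  odd-point⇒Q≢1 {P} r odd-P level Q≡1 =
    2*t≢1 (R - 2 * D) (ℤ.*-cancelˡ-≡ 2 _ _ (mod-4-clash R D norm-P))
    where
    R D : ℤ
    R = pow2 r * pow2 r
    D = proj₁ (odd-norm-mod-8 odd-P)
    norm-P : 1 + 1ℤ + 8 * D ≡ 4 * R
    norm-P = trans (cong (λ t → 1 + t + 8 * D) (sym Q≡1)) (trans (sym (proj₂ (odd-norm-mod-8 odd-P)))
                   (trans level (square-pow2-suc r)))
    mod-4-clash : ∀ R D → 1 + 1ℤ + 8 * D ≡ 4 * R → 2 * (2 * (R - 2 * D)) ≡ 2 * 1ℤ
    mod-4-clash R D eq = begin
      2 * (2 * (R - 2 * D))          ≡⟨ solve (R ∷ D ∷ []) ⟩
      4 * R - (1 + 1ℤ + 8 * D) + 2   ≡⟨ cong (λ a → 4 * R - a + 2) eq ⟩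
      4 * R - 4 * R + 2              ≡⟨ solve (R ∷ []) ⟩
      2 * 1ℤ                         ∎
      where open ≡-Reasoning

  ∝⇒∼ : ∀ {x y c X Y C} → norm (x , y) ≡ c * c → norm (X , Y) ≡ C * C →
        (x , y) ∝ (X , Y) → (x , y , c) ∼ (X , Y , C)
  ∝⇒∼ {x} {y} {c} {X} {Y} {C} norm-xy norm-XY (m , m′ , m≢0 , m′≢0 , eq) =
    m , m′ , m≢0 , m′≢0 , cong proj₁ eq , cong proj₂ eq , square-injective (m * c) (m′ * C) (begin
      m * c * (m * c)          ≡⟨ solve (m ∷ c ∷ []) ⟩
      m * m * (c * c)          ≡⟨ cong (m * m *_) norm-xy ⟨
      m * m * norm (x , y)     ≡⟨ norm-• m (x , y) ⟨
      norm (m • (x , y))       ≡⟨ cong norm eq ⟩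
      norm (m′ • (X , Y))      ≡⟨ norm-• m′ (X , Y) ⟩
      m′ * m′ * norm (X , Y)   ≡⟨ cong (m′ * m′ *_) norm-XY ⟩
      m′ * m′ * (C * C)        ≡⟨ solve (m′ ∷ C ∷ []) ⟩
      m′ * C * (m′ * C)        ∎)
    where open ≡-Reasoning

  divisible-point : ∀ {c u v} → c ∣ u → c ∣ v → ∃[ W ] c • W ≡ (u , v)
  divisible-point {c} (divides w refl) (divides z refl) = (w , z) , cong₂ _,_ (ℤ.*-comm c w) (ℤ.*-comm c z)

  exact-quotient : ∀ {P E W} p D → p ≢ 0ℤ →
    norm P ≡ 2 * p * D * (2 * p * D) → norm E ≡ 2 * p * (2 * p) → (2 * (p * p)) • W ≡ P · E →
    norm W ≡ 2 * D * (2 * D) × 2 • P ≡ W · conj E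
  exact-quotient {P} {E} {W} p D p≢0 norm-P norm-E eq =
    ℤ.*-cancelˡ-≡ (c * c) (norm W) (2 * D * (2 * D)) {{ℤ.≢-nonZero (*≢0 c≢0 c≢0)}} (begin
      c * c * norm W                        ≡⟨ norm-• c W ⟨
      norm (c • W)                          ≡⟨ cong norm eq ⟩
      norm (P · E)                          ≡⟨ norm-· P E ⟩
      norm P * norm E                       ≡⟨ cong₂ _*_ norm-P norm-E ⟩
      2 * p * D * (2 * p * D) * (2 * p * (2 * p))  ≡⟨ solve (p ∷ D ∷ []) ⟩
      2 * (p * p) * (2 * (p * p)) * (2 * D * (2 * D)) ∎) ,
    •-injective c≢0 (begin
      c • 2 • P               ≡⟨ •-• c 2 P ⟩
      (c * 2) • P             ≡⟨ cong (_• P) c*2≡norm ⟩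
      (2 * p * (2 * p)) • P   ≡⟨ cong (_• P) norm-E ⟨
      norm E • P              ≡⟨ ·-·conj P E ⟨
      P · E · conj E          ≡⟨ cong (_· conj E) eq ⟨
      (c • W) · conj E        ≡⟨ •-· c W (conj E) ⟨
      c • (W · conj E)        ∎)
    where
    open ≡-Reasoning
    c : ℤ
    c = 2 * (p * p)
    c≢0 : c ≢ 0ℤ
    c≢0 = *≢0 {2} (λ ()) (*≢0 p≢0 p≢0)
    c*2≡norm : 2 * (p * p) * 2 ≡ 2 * p * (2 * p)
    c*2≡norm = solve (p ∷ [])

  4∣-twiceOdd-norm : Odd Q → ∀ {u v} M → 4 ∣ u → TwiceOdd v → norm (u , v) ≢ 16 * M
  4∣-twiceOdd-norm odd-Q M (divides w refl) (t , odd-t , refl) eq =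
    odd⇒¬even (odd*odd odd-Q (odd*odd odd-t odd-t)) (2 * (M - w * w) , ℤ.*-cancelˡ-≡ 4 _ _ (begin
      4 * (Q * (t * t))                                         ≡⟨ solve (Q ∷ t ∷ w ∷ []) ⟩
      w * 4 * (w * 4) + Q * (2 * t * (2 * t)) - 16 * (w * w)   ≡⟨ cong (_- 16 * (w * w)) eq ⟩
      16 * M - 16 * (w * w)                                     ≡⟨ solve (M ∷ w ∷ []) ⟩
      4 * (2 * (2 * (M - w * w)))                               ∎))
    where open ≡-Reasoning

  -- With E of level 2 + j, the coordinates of P · E and P · conj E pair up as (u , u′) and (v , v′)
  -- with u + u′ = 2xe, v + v′ = 2ye, and u u′, v v′ divisible by 4^(2+j).  So 2^(3+2j) divides one
  -- member of each pair; if both lie in the same product, that product is 2^(3+2j) W, and otherwise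
  -- the product contradicts 4∣-twiceOdd-norm.
  module Descent (odd-Q : Odd Q) {x y e f : ℤ} (j d : ℕ) (odd-P : OddPoint (x , y)) (odd-E : OddPoint (e , f))
                 (level-P : Level (2 ℕ.+ j ℕ.+ d) (x , y)) (level-E : Level (2 ℕ.+ j) (e , f)) where
    open ≡-Reasoning

    P E : Point
    P = x , y
    E = e , f

    c D : ℤ
    c = pow2 j
    D = pow2 d

    n : ℕ
    n = suc j ℕ.+ suc j

    norm-P : norm P ≡ 2 * (2 * c) * D * (2 * (2 * c) * D)
    norm-P = trans level-P (cong₂ _*_ (pow2-2+j+d j d) (pow2-2+j+d j d))

    norm-E : norm E ≡ 2 * (2 * c) * (2 * (2 * c))
    norm-E = trans level-E (cong₂ _*_ (pow2-2+ j) (pow2-2+ j))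

    first-split : Split (pow2 (suc n)) (proj₁ (P · E)) (proj₁ (P · conj E))
    first-split = conjugate-split n (e * e * (D * D) - Q * (y * y)) (odd*odd (proj₁ odd-P) (proj₁ odd-E))
      (odd-odd (odd*odd (proj₁ odd-P) (proj₁ odd-E)) (odd*odd odd-Q (odd*odd (proj₂ odd-P) (proj₂ odd-E))))
      (sum Q x y e f) (begin
        (x * e - Q * (y * f)) * (x * e - Q * (y * - f))
          ≡⟨ product Q x y e f ⟩
        e * e * norm P - Q * (y * y) * norm E
          ≡⟨ cong₂ (λ a b → e * e * a - Q * (y * y) * b) norm-P norm-E ⟩
        e * e * (2 * (2 * c) * D * (2 * (2 * c) * D)) - Q * (y * y) * (2 * (2 * c) * (2 * (2 * c)))
          ≡⟨ factor Q y e c D ⟩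
        4 * (2 * c * (2 * c) * (e * e * (D * D) - Q * (y * y)))
          ≡⟨ cong (λ a → 4 * (a * (e * e * (D * D) - Q * (y * y)))) (pow2-double-suc j) ⟨
        4 * (pow2 n * (e * e * (D * D) - Q * (y * y))) ∎)
      where
      sum : ∀ Q x y e f → x * e - Q * (y * f) + (x * e - Q * (y * - f)) ≡ 2 * (x * e)
      sum = solve-∀
      product : ∀ Q x y e f → (x * e - Q * (y * f)) * (x * e - Q * (y * - f))
                                ≡ e * e * (x * x + Q * (y * y)) - Q * (y * y) * (e * e + Q * (f * f))
      product = solve-∀
      factor : ∀ Q y e c D →
        e * e * (2 * (2 * c) * D * (2 * (2 * c) * D)) - Q * (y * y) * (2 * (2 * c) * (2 * (2 * c)))
          ≡ 4 * (2 * c * (2 * c) * (e * e * (D * D) - Q * (y * y)))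
      factor = solve-∀

    second-split : Split (pow2 (suc n)) (proj₂ (P · E)) (proj₂ (P · conj E))
    second-split = conjugate-split n (y * y - f * f * (D * D)) (odd*odd (proj₂ odd-P) (proj₁ odd-E))
      (odd+odd (odd*odd (proj₁ odd-P) (proj₂ odd-E)) (odd*odd (proj₂ odd-P) (proj₁ odd-E)))
      (sum x y e f) (begin
        (x * f + y * e) * (x * - f + y * e)
          ≡⟨ product Q x y e f ⟩
        y * y * norm E - f * f * norm P
          ≡⟨ cong₂ (λ a b → y * y * b - f * f * a) norm-P norm-E ⟩
        y * y * (2 * (2 * c) * (2 * (2 * c))) - f * f * (2 * (2 * c) * D * (2 * (2 * c) * D))
          ≡⟨ factor y f c D ⟩
        4 * (2 * c * (2 * c) * (y * y - f * f * (D * D)))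
          ≡⟨ cong (λ a → 4 * (a * (y * y - f * f * (D * D)))) (pow2-double-suc j) ⟨
        4 * (pow2 n * (y * y - f * f * (D * D))) ∎)
      where
      sum : ∀ x y e f → x * f + y * e + (x * - f + y * e) ≡ 2 * (y * e)
      sum = solve-∀
      product : ∀ Q x y e f → (x * f + y * e) * (x * - f + y * e)
                                ≡ y * y * (e * e + Q * (f * f)) - f * f * (x * x + Q * (y * y))
      product = solve-∀
      factor : ∀ y f c D →
        y * y * (2 * (2 * c) * (2 * (2 * c))) - f * f * (2 * (2 * c) * D * (2 * (2 * c) * D))
          ≡ 4 * (2 * c * (2 * c) * (y * y - f * f * (D * D)))
      factor = solve-∀

    pow2-suc-n : pow2 (suc n) ≡ 2 * (2 * c * (2 * c))
    pow2-suc-n = trans (pow2-suc n) (cong (2 *_) (pow2-double-suc j))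

    quotient : ∀ {E′} → norm E′ ≡ norm E → pow2 (suc n) ∣ proj₁ (P · E′) → pow2 (suc n) ∣ proj₂ (P · E′) →
               ∃[ W ] Level (suc d) W × 2 • P ≡ W · conj E′
    quotient {E′} same-norm div-u div-v = W , level-W , proj₂ quotient-W
      where
      W : Point
      W = proj₁ (divisible-point div-u div-v)
      quotient-W : norm W ≡ 2 * D * (2 * D) × 2 • P ≡ W · conj E′
      quotient-W = exact-quotient (2 * c) D (*≢0 {2} (λ ()) (pow2≢0 j)) norm-P (trans same-norm norm-E)
                     (subst (λ a → a • W ≡ P · E′) pow2-suc-n (proj₂ (divisible-point div-u div-v)))
      level-W : Level (suc d) W
      level-W = trans (proj₁ quotient-W) (sym (cong₂ _*_ (pow2-suc d) (pow2-suc d)))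

    mixed : ∀ {E′} → norm E′ ≡ norm E → pow2 (suc n) ∣ proj₁ (P · E′) → TwiceOdd (proj₂ (P · E′)) → ⊥
    mixed {E′} same-norm div-u twice-odd-v =
      4∣-twiceOdd-norm odd-Q (2 * c * D * (2 * c * D) * (2 * c * (2 * c))) (∣-trans 4∣pow2-suc-n div-u) twice-odd-v (begin
        norm (P · E′)      ≡⟨ norm-· P E′ ⟩
        norm P * norm E′   ≡⟨ cong₂ _*_ norm-P (trans same-norm norm-E) ⟩
        2 * (2 * c) * D * (2 * (2 * c) * D) * (2 * (2 * c) * (2 * (2 * c)))  ≡⟨ factor c D ⟩
        16 * (2 * c * D * (2 * c * D) * (2 * c * (2 * c)))                      ∎)
      where
      factor : ∀ c D → 2 * (2 * c) * D * (2 * (2 * c) * D) * (2 * (2 * c) * (2 * (2 * c)))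
                        ≡ 16 * (2 * c * D * (2 * c * D) * (2 * c * (2 * c)))
      factor = solve-∀
      regroup : ∀ c → 2 * (2 * c * (2 * c)) ≡ 2 * (c * c) * 4
      regroup = solve-∀
      4∣pow2-suc-n : 4 ∣ pow2 (suc n)
      4∣pow2-suc-n = divides (2 * (c * c)) (trans pow2-suc-n (regroup c))

    descent-cases : Split (pow2 (suc n)) (proj₁ (P · E)) (proj₁ (P · conj E)) →
                    Split (pow2 (suc n)) (proj₂ (P · E)) (proj₂ (P · conj E)) →
                    ∃[ W ] Level (suc d) W × (2 • P ≡ W · E ⊎ 2 • P ≡ W · conj E)
    descent-cases (inj₁ (_ , div-u′)) (inj₁ (_ , div-v′)) =
      let W , level-W , twice-P = quotient {conj E} (norm-conj E) div-u′ div-v′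
      in W , level-W , inj₁ (trans twice-P (cong (W ·_) (conj-involutive E)))
    descent-cases (inj₂ (_ , div-u)) (inj₂ (_ , div-v)) =
      let W , level-W , twice-P = quotient {E} refl div-u div-v
      in W , level-W , inj₂ twice-P
    descent-cases (inj₁ (_ , div-u′)) (inj₂ (twice-odd-v′ , _)) = ⊥-elim (mixed {conj E} (norm-conj E) div-u′ twice-odd-v′)
    descent-cases (inj₂ (_ , div-u)) (inj₁ (twice-odd-v , _)) = ⊥-elim (mixed {E} refl div-u twice-odd-v)

    descent : ∃[ W ] Level (suc d) W × (2 • P ≡ W · E ⊎ 2 • P ≡ W · conj E)
    descent = descent-cases first-split second-split

  open Descent public using (descent)

square-* : ∀ a b → a * a * (b * b) ≡ a * b * (a * b)
square-* = solve-∀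

square-abs : ∀ x → x * x ≡ + (∣ x ∣ ℕ.* ∣ x ∣)
square-abs (+ n)    = sym (ℤ.pos-* n n)
square-abs -[1+ n ] = refl

unit-abs : ∀ {x} → ∣ x ∣ ≡ 1 → x ≡ 1ℤ ⊎ x ≡ -1ℤ
unit-abs {+ .1}      refl = inj₁ refl
unit-abs { -[1+ 0 ]} refl = inj₂ refl

units-equal-up-to-sign : ∀ {x a} → ∣ x ∣ ≡ 1 → ∣ a ∣ ≡ 1 → x ≡ a ⊎ x ≡ - a
units-equal-up-to-sign {x} {a} ∣x∣≡1 ∣a∣≡1 with unit-abs {x} ∣x∣≡1 | unit-abs {a} ∣a∣≡1
... | inj₁ refl | inj₁ refl = inj₁ refl
... | inj₁ refl | inj₂ refl = inj₂ refl
... | inj₂ refl | inj₁ refl = inj₂ refl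
... | inj₂ refl | inj₂ refl = inj₁ refl

sum-of-squares≡1 : ∀ {q} X Y → 2 ≤ q → X ℕ.* X ℕ.+ q ℕ.* (Y ℕ.* Y) ≡ 1 → X ≡ 1 × Y ≡ 0
sum-of-squares≡1 {q} X (suc Y) q≥2 eq = ⊥-elim (ℕ.<-irrefl (sym eq) (begin-strict
  1                                  <⟨ q≥2 ⟩
  q                                  ≤⟨ ℕ.m≤m*n q (suc Y ℕ.* suc Y) ⟩
  q ℕ.* (suc Y ℕ.* suc Y)            ≤⟨ ℕ.m≤n+m _ (X ℕ.* X) ⟩
  X ℕ.* X ℕ.+ q ℕ.* (suc Y ℕ.* suc Y) ∎))
  where open ℕ.≤-Reasoning
sum-of-squares≡1 {q} X zero _ eq =
  ℕ.m*n≡1⇒m≡1 X X (trans (sym (trans (cong (X ℕ.* X ℕ.+_) (ℕ.*-zeroʳ q)) (ℕ.+-identityʳ (X ℕ.* X)))) eq) , refl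

sum-of-squares≡4 : ∀ {q} X Y → 1 ≤ q → X ≢ 0 → Y ≢ 0 → X ℕ.* X ℕ.+ q ℕ.* (Y ℕ.* Y) ≡ 4 → X ≡ 1 × Y ≡ 1
sum-of-squares≡4 zero _ _ X≢0 _ _ = ⊥-elim (X≢0 refl)
sum-of-squares≡4 _ zero _ _ Y≢0 _ = ⊥-elim (Y≢0 refl)
sum-of-squares≡4 1 1 _ _ _ _ = refl , refl
sum-of-squares≡4 {q} (suc (suc X)) (suc Y) q≥1 _ _ eq = ⊥-elim (ℕ.<-irrefl (sym eq)
  (ℕ.+-mono-≤ (ℕ.*-mono-≤ {2} {suc (suc X)} {2} (s≤s (s≤s z≤n)) (s≤s (s≤s z≤n)))
              (ℕ.*-mono-≤ q≥1 (ℕ.*-mono-≤ {1} {suc Y} {1} (s≤s z≤n) (s≤s z≤n)))))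
sum-of-squares≡4 {q} 1 (suc (suc Y)) q≥1 _ _ eq = ⊥-elim (ℕ.<-irrefl (sym eq)
  (ℕ.+-mono-≤ {1} {1} (s≤s z≤n) (ℕ.*-mono-≤ q≥1 (ℕ.*-mono-≤ {2} {suc (suc Y)} {2} (s≤s (s≤s z≤n)) (s≤s (s≤s z≤n))))))

module PositiveForm (q : ℕ) where
  open Points (+ q)

  norm-abs : ∀ x y → norm (x , y) ≡ + (∣ x ∣ ℕ.* ∣ x ∣ ℕ.+ q ℕ.* (∣ y ∣ ℕ.* ∣ y ∣))
  norm-abs x y = begin
    x * x + + q * (y * y)                                       ≡⟨ cong₂ (λ a b → a + + q * b) (square-abs x) (square-abs y) ⟩
    + (∣ x ∣ ℕ.* ∣ x ∣) + + q * + (∣ y ∣ ℕ.* ∣ y ∣)              ≡⟨ cong (λ t → + (∣ x ∣ ℕ.* ∣ x ∣) + t) (ℤ.pos-* q _) ⟨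
    + (∣ x ∣ ℕ.* ∣ x ∣) + + (q ℕ.* (∣ y ∣ ℕ.* ∣ y ∣))            ≡⟨ ℤ.pos-+ (∣ x ∣ ℕ.* ∣ x ∣) (q ℕ.* (∣ y ∣ ℕ.* ∣ y ∣)) ⟨
    + (∣ x ∣ ℕ.* ∣ x ∣ ℕ.+ q ℕ.* (∣ y ∣ ℕ.* ∣ y ∣))              ∎
    where open ≡-Reasoning

  level-zero : 2 ≤ q → ∀ {x y} → Level 0 (x , y) → x ≢ 0ℤ × y ≡ 0ℤ
  level-zero q≥2 {x} {y} level with sum-of-squares≡1 ∣ x ∣ ∣ y ∣ q≥2 (ℤ.+-injective (trans (sym (norm-abs x y)) level))
  ... | ∣x∣≡1 , ∣y∣≡0 = (λ x≡0 → ℕ.1+n≢0 (trans (sym ∣x∣≡1) (cong ∣_∣ x≡0))) , ℤ.∣i∣≡0⇒i≡0 ∣y∣≡0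

  level-one-units : 1 ≤ q → ∀ {x y} → OddPoint (x , y) → Level 1 (x , y) → ∣ x ∣ ≡ 1 × ∣ y ∣ ≡ 1
  level-one-units q≥1 {x} {y} (odd-x , odd-y) level =
    sum-of-squares≡4 ∣ x ∣ ∣ y ∣ q≥1 (odd-abs≢0 odd-x) (odd-abs≢0 odd-y) (ℤ.+-injective (trans (sym (norm-abs x y)) level))
    where
    odd-abs≢0 : ∀ {z} → Odd z → ∣ z ∣ ≢ 0
    odd-abs≢0 odd-z ∣z∣≡0 = odd⇒≢0 odd-z (ℤ.∣i∣≡0⇒i≡0 ∣z∣≡0)

  units-∝ : ∀ {x y a b} → ∣ x ∣ ≡ 1 → ∣ y ∣ ≡ 1 → ∣ a ∣ ≡ 1 → ∣ b ∣ ≡ 1 →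
            (x , y) ∝ (a , b) ⊎ (x , y) ∝ conj (a , b)
  units-∝ {x} {y} {a} {b} ∣x∣ ∣y∣ ∣a∣ ∣b∣ with units-equal-up-to-sign {x} {a} ∣x∣ ∣a∣ | units-equal-up-to-sign {y} {b} ∣y∣ ∣b∣
  ... | inj₁ refl | inj₁ refl = inj₁ (∝-reflexive refl)
  ... | inj₁ refl | inj₂ refl = inj₂ (∝-reflexive refl)
  ... | inj₂ refl | inj₂ refl = inj₁ (negated a b)
  ... | inj₂ refl | inj₁ refl = inj₂ (∝-trans (∝-reflexive (cong (- a ,_) (sym (ℤ.neg-involutive b)))) (negated a (- b)))

odd⇒¬2∣ : ∀ {e} → Odd e → ¬ (2 ℕ.∣ ∣ e ∣)
odd⇒¬2∣ {e} odd-e 2∣e with ∣ᵤ⇒∣ {+ 2} {e} 2∣e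
... | divides k eq = odd⇒¬even odd-e (k , trans eq (ℤ.*-comm k 2))

∣odd⇒coprime-2 : ∀ {e d} → Odd e → d ℕ.∣ ∣ e ∣ → ℕ.Coprime d 2
∣odd⇒coprime-2 _ _ {0} (_ , 0∣2) with ℕ.0∣⇒≡0 0∣2
... | ()
∣odd⇒coprime-2 _ _ {1} _ = refl
∣odd⇒coprime-2 odd-e d∣e {2} (2∣d , _) = ⊥-elim (odd⇒¬2∣ odd-e (ℕ.∣-trans 2∣d d∣e))
∣odd⇒coprime-2 _ _ {suc (suc (suc i))} (_ , i∣2) with ℕ.∣⇒≤ i∣2
... | s≤s (s≤s ())

∣pow2∧∣odd⇒≡1 : ∀ j {e d} → Odd e → d ℕ.∣ 2 ^ j → d ℕ.∣ ∣ e ∣ → d ≡ 1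
∣pow2∧∣odd⇒≡1 zero    _     d∣1   _   = ℕ.∣1⇒≡1 d∣1
∣pow2∧∣odd⇒≡1 (suc j) odd-e d∣2^j d∣e =
  ∣pow2∧∣odd⇒≡1 j odd-e (ℕ.coprime-divisor (∣odd⇒coprime-2 odd-e d∣e) d∣2^j) d∣e

odd-primitive : ∀ {e} f j → Odd e → Primitive (e , f , pow2 j)
odd-primitive {e} f j odd-e = cong +_ (∣pow2∧∣odd⇒≡1 j odd-e
  (ℕ.∣-trans (ℕ.gcd[m,n]∣n ∣ e ∣ _) (ℕ.gcd[m,n]∣n ∣ f ∣ (2 ^ j))) (ℕ.gcd[m,n]∣m ∣ e ∣ _))

2∣∣2*∣ : ∀ s → 2 ℕ.∣ ∣ 2 * s ∣
2∣∣2*∣ s = ℕ.divides ∣ s ∣ (trans (ℤ.abs-* 2 s) (ℕ.*-comm 2 ∣ s ∣))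

2∣gcd : ∀ s t k → 2 ℕ.∣ ∣ ℤ.gcd (2 * s) (ℤ.gcd (2 * t) (pow2 (suc k))) ∣
2∣gcd s t k = ℤ.gcd-greatest {2 * s} {ℤ.gcd (2 * t) (pow2 (suc k))} {+ 2} (2∣∣2*∣ s)
  (ℤ.gcd-greatest {2 * t} {pow2 (suc k)} {+ 2} (2∣∣2*∣ t) (ℕ.divides (2 ^ k) (ℕ.*-comm 2 (2 ^ k))))

primitive⇒¬both-even : ∀ {a b} k → Primitive (a , b , pow2 (suc k)) → Even a → Even b → ⊥
primitive⇒¬both-even k prim (s , refl) (t , refl) with ℕ.∣1⇒≡1 (subst (λ g → 2 ℕ.∣ ∣ g ∣) prim (2∣gcd s t k))
... | ()

odd-≢1⇒≥2 : ∀ {q} → Odd (+ q) → + q ≢ 1ℤ → 2 ≤ q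
odd-≢1⇒≥2 {zero}          odd-q _   = ⊥-elim (odd⇒≢0 odd-q refl)
odd-≢1⇒≥2 {suc zero}      _     q≢1 = ⊥-elim (q≢1 refl)
odd-≢1⇒≥2 {suc (suc _)}   _     _   = s≤s (s≤s z≤n)

point : Triple → ℤ × ℤ
point (a , b , _) = a , b

module Multiples (q : ℕ) (g : Triple) where
  open Points (+ q)

  multiple : ℤ → Point
  multiple n = point (zMul q n g)

  module _ (norm-g : norm (point g) ≡ third g * third g) where

    norm-natMul : ∀ n → norm (point (natMul q n g)) ≡ third (natMul q n g) * third (natMul q n g)
    norm-natMul zero    = cong (λ t → 1ℤ + t) (ℤ.*-zeroʳ (+ q))
    norm-natMul (suc n) = begin
      norm (point (natMul q n g) · point g)               ≡⟨ norm-· (point (natMul q n g)) (point g) ⟩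
      norm (point (natMul q n g)) * norm (point g)        ≡⟨ cong₂ _*_ (norm-natMul n) norm-g ⟩
      third (natMul q n g) * third (natMul q n g) * (third g * third g) ≡⟨ square-* (third (natMul q n g)) (third g) ⟩
      third (natMul q n g) * third g * (third (natMul q n g) * third g) ∎
      where open ≡-Reasoning

    norm-multiple : ∀ n → norm (multiple n) ≡ third (zMul q n g) * third (zMul q n g)
    norm-multiple (+ n)    = norm-natMul n
    norm-multiple -[1+ n ] = trans (norm-conj (point (natMul q (suc n) g))) (norm-natMul (suc n))

  module _ (norm-g≢0 : norm (point g) ≢ 0ℤ) where

    multiple-· : ∀ n → ∃[ n′ ] multiple n · point g ∝ multiple n′
    multiple-· (+ n)          = + suc n , ∝-reflexive refl
    multiple-· -[1+ zero ]    = + 0 , ∝-trans (∝-reflexive (conj[·]-· (1ℤ , 0ℤ) (point g))) (•-∝ (1ℤ , 0ℤ) norm-g≢0)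
    multiple-· -[1+ suc n ]   = -[1+ n ] ,
      ∝-trans (∝-reflexive (conj[·]-· (point (natMul q (suc n) g)) (point g))) (•-∝ _ norm-g≢0)

    multiple-·conj : ∀ n → ∃[ n′ ] multiple n · conj (point g) ∝ multiple n′
    multiple-·conj (+ zero)  = -[1+ 0 ] ,
      ∝-reflexive (trans (1·-identity (conj (point g))) (cong conj (sym (1·-identity (point g)))))
    multiple-·conj (+ suc n) = + n , ∝-trans (∝-reflexive (·-·conj (multiple (+ n)) (point g))) (•-∝ _ norm-g≢0)
    multiple-·conj -[1+ n ]  = -[1+ suc n ] , ∝-reflexive (sym (conj-· (point (natMul q (suc n) g)) (point g)))

module Generation (q : ℕ) (q≥2 : 2 ≤ q) (odd-q : Odd (+ q)) (a b : ℤ) (k : ℕ)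
  (odd-g : Points.OddPoint (+ q) (a , b)) (level-g : Points.Level (+ q) (suc k) (a , b))
  (no-odd-below : ∀ {j E} → 1 ≤ j → j < suc k → Points.OddPoint (+ q) E → Points.Level (+ q) j E → ⊥) where
  open Points (+ q)
  open PositiveForm q
  open Multiples q (a , b , pow2 (suc k))

  Generated : Point → Set
  Generated P = ∃[ n ] P ∝ multiple n

  norm-g≢0 : norm (a , b) ≢ 0ℤ
  norm-g≢0 eq = *≢0 (pow2≢0 (suc k)) (pow2≢0 (suc k)) (trans (sym level-g) eq)

  next-multiple : ∀ {P W} n → W ∝ multiple n → P ∝ W · (a , b) ⊎ P ∝ W · conj (a , b) → Generated P
  next-multiple n W∝ (inj₁ P∝) =
    let n′ , ∝n′ = multiple-· norm-g≢0 n in n′ , ∝-trans P∝ (∝-trans (∝-·ʳ (a , b) W∝) ∝n′)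
  next-multiple n W∝ (inj₂ P∝) =
    let n′ , ∝n′ = multiple-·conj norm-g≢0 n in n′ , ∝-trans P∝ (∝-trans (∝-·ʳ (conj (a , b)) W∝) ∝n′)

  -- k and level-g are re-quantified here because module parameters cannot be split on.
  odd-generated-above : ∀ k′ r d → suc k′ ℕ.+ d ≡ suc r → Level (suc k′) (a , b) → OddPoint (a , b) →
              (∀ {r′} → r′ < suc r → ∀ P → Level r′ P → Generated P) →
              ∀ {P} → OddPoint P → Level (suc r) P → Generated P
  odd-generated-above zero _ zero refl level-g odd-g _ odd-P level-P =
    let ∣x∣ , ∣y∣ = level-one-units (ℕ.≤-trans (s≤s z≤n) q≥2) odd-P level-P
        ∣a∣ , ∣b∣ = level-one-units (ℕ.≤-trans (s≤s z≤n) q≥2) odd-g level-g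
    in next-multiple (+ 0) (∝-reflexive refl)
         (Sum.map (λ P∝ → ∝-trans P∝ (∝-reflexive (sym (1·-identity (a , b)))))
                  (λ P∝ → ∝-trans P∝ (∝-reflexive (sym (1·-identity (conj (a , b))))))
                  (units-∝ ∣x∣ ∣y∣ ∣a∣ ∣b∣))
  odd-generated-above zero _ (suc d) refl level-g odd-g _ odd-P level-P =
    ⊥-elim (odd-level-one⇒no-odd-level-2+ d odd-g level-g odd-P level-P)
  odd-generated-above (suc j) _ d refl level-g odd-g IH odd-P level-P =
    let W , level-W , twice-P = descent odd-q j d odd-P odd-g level-P level-g
        n , W∝ = IH (s≤s (s≤s (ℕ.m≤n+m d j))) W level-W
    in next-multiple n W∝ (Sum.map (•≡⇒∝ {2} (λ ())) (•≡⇒∝ {2} (λ ())) twice-P)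

  odd-generated : ∀ r → (∀ {r′} → r′ < suc r → ∀ P → Level r′ P → Generated P) →
                  ∀ {P} → OddPoint P → Level (suc r) P → Generated P
  odd-generated r IH odd-P level-P with suc r ℕ.<? suc k
  ... | yes r<k = ⊥-elim (no-odd-below (s≤s z≤n) r<k odd-P level-P)
  ... | no r≮k with ℕ.m≤n⇒∃[o]m+o≡n (ℕ.≮⇒≥ r≮k)
  ... | d , k+d≡r = odd-generated-above k r d k+d≡r level-g odd-g IH odd-P level-P

  generated : ∀ r P → Level r P → Generated P
  generated = <-rec (λ r → ∀ P → Level r P → Generated P) step
    where
    step : ∀ r → (∀ {r′} → r′ < r → ∀ P → Level r′ P → Generated P) → ∀ P → Level r P → Generated P
    step zero _ (x , y) level with level-zero q≥2 {x} {y} level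
    ... | x≢0 , refl = + 0 , 1ℤ , x , (λ ()) , x≢0 ,
      cong₂ _,_ (trans (ℤ.*-identityˡ x) (sym (ℤ.*-identityʳ x))) (sym (ℤ.*-zeroʳ x))
    step (suc r) IH (x , y) level with level-suc-parity odd-q {r} {x} {y} level
    ... | inj₂ odd-P = odd-generated r IH odd-P level
    ... | inj₁ ((x′ , refl) , (y′ , refl)) with IH {r} ℕ.≤-refl (x′ , y′) (level-halve {r} (x′ , y′) level)
    ... | n , P′∝ = n , ∝-trans (•-∝ {2} (x′ , y′) (λ ())) P′∝

module Irreducibility (q : ℕ) where
  open Points (+ q)

  Decomposable : Triple → Set
  Decomposable t = ∃[ t₁ ] ∃[ t₂ ] InT q t₁ × Primitive t₁ × InT q t₂ × Primitive t₂ ×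
    (1ℤ ℤ.< third t₁) × (third t₁ ℤ.< third t) × (1ℤ ℤ.< third t₂) × (third t₂ ℤ.< third t) ×
    (t ∼ add q t₁ t₂)

  decomposable : ∀ {k l m w z e f P} → Level k P → Odd w → Level l (w , z) → Odd e → Level m (e , f) →
                 0 < l → l < k → 0 < m → m < k → P ∝ (w , z) · (e , f) → Decomposable (proj₁ P , proj₂ P , pow2 k)
  decomposable {k} {l} {m} {w} {z} {e} {f} level-P odd-w level-W odd-e level-E 0<l l<k 0<m m<k P∝ =
    (w , z , pow2 l) , (e , f , pow2 m) ,
    (level-W , pow2-pos l) , odd-primitive z l odd-w , (level-E , pow2-pos m) , odd-primitive f m odd-e ,
    pow2-mono-< 0<l , pow2-mono-< l<k , pow2-mono-< 0<m , pow2-mono-< m<k ,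
    ∝⇒∼ level-P (trans (norm-· (w , z) (e , f)) (trans (cong₂ _*_ level-W level-E) (square-* (pow2 l) (pow2 m)))) P∝

  square-free⇒odd : SquareFree q → ∀ {a b} k → Primitive (a , b , pow2 (suc k)) → Level (suc k) (a , b) → Odd (+ q)
  square-free⇒odd square-free {a} {b} k prim level with parity (+ q)
  ... | inj₂ odd-q = odd-q
  ... | inj₁ (Q₁ , q≡2Q₁) with parity a | parity b
  ...   | inj₂ odd-a | _ = ⊥-elim (odd⇒¬even
    (subst Odd level (odd+even (odd*odd odd-a odd-a) (subst (λ t → Even (t * (b * b))) (sym q≡2Q₁) (even*ˡ (b * b) (Q₁ , refl)))))
    (square-pow2-suc-even k))
  ...   | inj₁ even-a | inj₁ even-b = ⊥-elim (primitive⇒¬both-even k prim even-a even-b)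
  ...   | inj₁ (a₁ , refl) | inj₂ odd-b with parity Q₁
  ...     | inj₂ odd-Q₁ = ⊥-elim (odd⇒¬even (odd*odd odd-Q₁ (odd*odd odd-b odd-b))
    (pow2 k * pow2 k - a₁ * a₁ , ℤ.*-cancelˡ-≡ 2 _ _ (begin
      2 * (Q₁ * (b * b))                                          ≡⟨ solve (Q₁ ∷ a₁ ∷ b ∷ []) ⟩
      2 * a₁ * (2 * a₁) + 2 * Q₁ * (b * b) - 4 * (a₁ * a₁)       ≡⟨ cong (λ t → 2 * a₁ * (2 * a₁) + t * (b * b) - 4 * (a₁ * a₁)) q≡2Q₁ ⟨
      norm (2 * a₁ , b) - 4 * (a₁ * a₁)                           ≡⟨ cong (_- 4 * (a₁ * a₁)) level ⟩
      pow2 (suc k) * pow2 (suc k) - 4 * (a₁ * a₁)                 ≡⟨ factor (pow2 k) a₁ (pow2-suc k) ⟩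
      2 * (2 * (pow2 k * pow2 k - a₁ * a₁))                       ∎)))
    where
    open ≡-Reasoning
    factor : ∀ c a₁ {c′} → c′ ≡ 2 * c → c′ * c′ - 4 * (a₁ * a₁) ≡ 2 * (2 * (c * c - a₁ * a₁))
    factor c a₁ refl = solve (c ∷ a₁ ∷ [])
  ...     | inj₁ (Q₂ , refl) with square-free 2 (ℕ.divides ∣ Q₂ ∣ (begin
      q                             ≡⟨ cong ∣_∣ q≡2Q₁ ⟩
      ∣ 2 * (2 * Q₂) ∣              ≡⟨ ℤ.abs-* 2 (2 * Q₂) ⟩
      2 ℕ.* ∣ 2 * Q₂ ∣              ≡⟨ cong (2 ℕ.*_) (ℤ.abs-* 2 Q₂) ⟩
      2 ℕ.* (2 ℕ.* ∣ Q₂ ∣)          ≡⟨ ℕ.*-assoc 2 2 ∣ Q₂ ∣ ⟨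
      2 ℕ.* 2 ℕ.* ∣ Q₂ ∣            ≡⟨ ℕ.*-comm (2 ℕ.* 2) ∣ Q₂ ∣ ⟩
      ∣ Q₂ ∣ ℕ.* (2 ℕ.* 2)          ∎))
    where open ≡-Reasoning
  ...     | ()

  irreducible-odd : SquareFree q → ∀ {a b} k → Primitive (a , b , pow2 (suc k)) → Level (suc k) (a , b) →
                    Odd (+ q) × OddPoint (a , b)
  irreducible-odd square-free {a} {b} k prim level =
    let odd-q = square-free⇒odd square-free {a} {b} k prim level
    in [ (λ (even-a , even-b) → ⊥-elim (primitive⇒¬both-even k prim even-a even-b)) , (odd-q ,_) ]′
       (level-suc-parity odd-q {k} {a} {b} level)

  decomposable-below : ∀ {i d l a b w z e f} → Level (3 ℕ.+ i ℕ.+ d) (a , b) →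
                       Odd w → Level (suc l) (w , z) → l ≤ suc d → Odd e → Level (2 ℕ.+ i) (e , f) →
                       (a , b) ∝ (w , z) · (e , f) → Decomposable (a , b , pow2 (3 ℕ.+ i ℕ.+ d))
  decomposable-below {i} {d} {l} {a} {b} {w} {z} {e} {f} level-g odd-w level-W l≤1+d odd-e level-E =
    decomposable {3 ℕ.+ i ℕ.+ d} {suc l} {2 ℕ.+ i} {w} {z} {e} {f} {a , b} level-g odd-w level-W odd-e level-E
      (s≤s z≤n) (s≤s (s≤s (ℕ.≤-trans l≤1+d (s≤s (ℕ.m≤n+m d i))))) (s≤s z≤n) (s≤s (s≤s (s≤s (ℕ.m≤m+n i d))))

  no-odd-quotient : Odd (+ q) → ∀ {a b i d e f W} → Odd a → Level (3 ℕ.+ i ℕ.+ d) (a , b) →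
                    ¬ Decomposable (a , b , pow2 (3 ℕ.+ i ℕ.+ d)) → Odd e → Level (2 ℕ.+ i) (e , f) →
                    Level (2 ℕ.+ d) W → 2 • (a , b) ≡ W · (e , f) → ⊥
  no-odd-quotient odd-q {a} {b} {i} {d} {e} {f} {w , z} odd-a level-g indecomposable odd-e level-E level-W twice-g
    with level-suc-parity odd-q {suc d} {w} {z} level-W
  ... | inj₂ (odd-w , _) = indecomposable
    (decomposable-below {i} {d} {suc d} {a} {b} {w} {z} {e} {f} level-g odd-w level-W ℕ.≤-refl odd-e level-E (•≡⇒∝ {2} (λ ()) twice-g))
  ... | inj₁ ((w₁ , refl) , (z₁ , refl)) with level-suc-parity odd-q {d} {w₁} {z₁} (level-halve {suc d} (w₁ , z₁) level-W)
  ...   | inj₂ (odd-w₁ , _) = indecomposable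
    (decomposable-below {i} {d} {d} {a} {b} {w₁} {z₁} {e} {f} level-g odd-w₁ (level-halve {suc d} (w₁ , z₁) level-W) (ℕ.n≤1+n d) odd-e level-E
      (∝-reflexive (•-injective {2} (λ ()) (trans twice-g (sym (•-· 2 (w₁ , z₁) (e , f)))))))
  ...   | inj₁ ((w₂ , refl) , (z₂ , refl)) = odd⇒¬even odd-a (proj₁ ((w₂ , z₂) · (e , f)) , cong proj₁ g≡)
    where
    g≡ : (a , b) ≡ 2 • ((w₂ , z₂) · (e , f))
    g≡ = •-injective {2} (λ ()) (trans twice-g (trans (sym (•-· 2 (2 • (w₂ , z₂)) (e , f)))
                                                 (cong (2 •_) (sym (•-· 2 (w₂ , z₂) (e , f))))))

  no-odd-below : Odd (+ q) → ∀ {a b} k → OddPoint (a , b) → Level k (a , b) → ¬ Decomposable (a , b , pow2 k) →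
                 ∀ {j E} → 1 ≤ j → j < k → OddPoint E → Level j E → ⊥
  no-odd-below _ k odd-g level-g _ {suc zero} _ 1<k odd-E level-E with ℕ.m≤n⇒∃[o]m+o≡n 1<k
  ... | r , refl = odd-level-one⇒no-odd-level-2+ r odd-E level-E odd-g level-g
  no-odd-below odd-q {a} {b} k odd-g level-g indecomposable {suc (suc i)} {e , f} _ j<k odd-E level-E
    with ℕ.m≤n⇒∃[o]m+o≡n j<k
  ... | d , refl =
    let W , level-W , twice-g = descent odd-q i (suc d) odd-g odd-E level-g′ level-E
    in [ no-odd-quotient odd-q {a} {b} {i} {d} {e} {f} {W} (proj₁ odd-g) level-g indecomposable (proj₁ odd-E) level-E level-W
       , no-odd-quotient odd-q {a} {b} {i} {d} {e} { - f} {W} (proj₁ odd-g) level-g indecomposable (proj₁ odd-E)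
           (trans (norm-conj (e , f)) level-E) level-W
       ]′ twice-g
    where
    level-g′ : Level (2 ℕ.+ i ℕ.+ suc d) (a , b)
    level-g′ = subst (λ n → Level n (a , b)) (cong (λ n → suc (suc n)) (sym (ℕ.+-suc i d))) level-g

theorem3 : (q : ℕ) → q > 0 → SquareFree q →
    (a b : ℤ) (k : ℕ) → Irreducible q (a , b , + (2 ^ k)) →
    (x y : ℤ) (r : ℕ) → InT q (x , y , + (2 ^ r)) → k ≤ r →
    ∃[ n ] ((x , y , + (2 ^ r)) ∼ zMul q n (a , b , + (2 ^ k)))
theorem3 q _ _ a b zero (_ , _ , ℤ.+<+ (s≤s ()) , _) _ _ _ _ _
theorem3 q _ square-free a b (suc k) ((level-g , _) , prim , _ , indecomposable) x y r (level-P , _) _ =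
  as-triples (generated r (x , y) level-P)
  where
  open Points (+ q)
  open Irreducibility q
  open Multiples q (a , b , pow2 (suc k))
  odd-q : Odd (+ q)
  odd-q = proj₁ (irreducible-odd square-free {a} {b} k prim level-g)
  odd-g : OddPoint (a , b)
  odd-g = proj₂ (irreducible-odd square-free {a} {b} k prim level-g)
  open Generation q (odd-≢1⇒≥2 odd-q (odd-point⇒Q≢1 {a , b} k odd-g level-g)) odd-q a b k odd-g level-g
                    (no-odd-below odd-q {a} {b} (suc k) odd-g level-g indecomposable)
  as-triples : Generated (x , y) → ∃[ n ] ((x , y , pow2 r) ∼ zMul q n (a , b , pow2 (suc k)))
  as-triples (n , P∝) = n , ∝⇒∼ level-P (norm-multiple level-g n) P∝
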